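{- Let $\mathbf E=(E,+,{}',0,1)$ be an effect algebra with induced order $\leq$ and let $a,b\in E$ be comparable (i.e.\ $a\leq b$ or $b\leq a$). Then $U(a\rightarrow b)=U(b'\rightarrow a')$.
   Context: An effect algebra is a partial algebra $(E,+,{}',0,1)$ of type $(2,1,0,0)$ where $+$ is a partial binary operation such that for all $x,y,z\in E$: (E1) $x+y$ is defined iff $y+x$ is defined, and then $x+y=y+x$; (E2) $(x+y)+z$ is defined iff $x+(y+z)$ is defined, and then they are equal; (E3) $x'$ is the unique $u\in E$ with $x+u=1$; (E4) if $1+x$ is defined then $x=0$. The induced order is $x\leq y$ iff $x+z=y$ for some $z$; $x+y$ is defined iff $x\leq y'$. $L(A)$, $U(A)$ denote the sets of lower, resp. upper, bounds of $A\subseteq E$, $L(x,y)=L(\{x,y\})$. The implication is the subset $x\rightarrow y:=x'+L(x,y)=\{x'+u\mid u\in L(x,y)\}$. -}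

module Defs where

open import Level using (Level; _⊔_; suc)
open import Data.Product using (Σ; _×_; _,_; ∃)
open import Data.Sum using (_⊎_)
open import Relation.Binary.PropositionalEquality using (_≡_)

-- An effect algebra with carrier E. The partial operation + is encoded as its
-- graph: Sum x y z means "x + y is defined and x + y = z".
record EffectAlgebra (a : Level) : Set (suc a) where
  field
    Carrier : Set a
    Sum     : Carrier → Carrier → Carrier → Set a
    _′      : Carrier → Carrier
    𝟘 𝟙     : Carrier
    Sum-functional : ∀ {x y z w} → Sum x y z → Sum x y w → z ≡ w
    E1 : ∀ {x y z} → Sum x y z → Sum y x z
    E2→ : ∀ {x y z u w} → Sum x y u → Sum u z w →
          Σ Carrier λ v → Sum y z v × Sum x v w
    E2← : ∀ {x y z v w} → Sum y z v → Sum x v w →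
          Σ Carrier λ u → Sum x y u × Sum u z w
    E3-sum  : ∀ x → Sum x (x ′) 𝟙
    E3-uniq : ∀ {x u} → Sum x u 𝟙 → u ≡ x ′
    E4 : ∀ {x z} → Sum 𝟙 x z → x ≡ 𝟘

module EffectAlgebraTheory {a : Level} (𝐄 : EffectAlgebra a) where
  open EffectAlgebra 𝐄 public

  Subset : Set (suc a)
  Subset = Carrier → Set a

  _≤_ : Carrier → Carrier → Set a
  x ≤ y = Σ Carrier λ z → Sum x z y

  L : Subset → Subset
  L A w = ∀ v → A v → w ≤ v

  U : Subset → Subset
  U A w = ∀ v → A v → v ≤ w

  pair : Carrier → Carrier → Subset
  pair x y v = (v ≡ x) ⊎ (v ≡ y)

  L₂ : Carrier → Carrier → Subset
  L₂ x y = L (pair x y)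

  -- implication  x → y := x′ + L(x,y) = { x′ + u | u ∈ L(x,y) }
  _⇒_ : Carrier → Carrier → Subset
  (x ⇒ y) w = Σ Carrier λ u → L₂ x y u × Sum (x ′) u w

  _≐_ : Subset → Subset → Set a
  A ≐ B = (∀ v → A v → B v) × (∀ v → B v → A v)

-- If a ≤ b then 1 = a′ + a lies in a → b and 1 = b″ + b′ lies in b′ → a′, so
-- both sets have greatest element 1. If b ≤ a then L(a,b) = L(b) and
-- L(b′,a′) = L(a′), so a → b = a′ + L(b) and b′ → a′ = b + L(a′) both have
-- greatest element a′ + b. A set with a greatest element m has U = U({m}).
module Submission where

open import Defs
open import Level using (Level)
open import Data.Sum using (_⊎_; inj₁; inj₂)
open import Data.Product using (Σ; _×_; _,_)
open import Relation.Binary.PropositionalEquality using (_≡_; refl; sym; subst)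

module EffectAlgebraProperties {ℓ : Level} (𝐄 : EffectAlgebra ℓ) where
  open EffectAlgebraTheory 𝐄

  ′-involutive : ∀ x → x ≡ (x ′) ′
  ′-involutive x = E3-uniq (E1 (E3-sum x))

  𝟙′≡𝟘 : 𝟙 ′ ≡ 𝟘
  𝟙′≡𝟘 = E4 (E3-sum 𝟙)

  +-identityʳ : ∀ x → Sum x 𝟘 x
  +-identityʳ x with E2→ (E3-sum (x ′)) (subst (λ z → Sum 𝟙 z 𝟙) 𝟙′≡𝟘 (E3-sum 𝟙))
  ... | v , x″+𝟘≡v , x′+v≡𝟙 =
    subst (λ t → Sum t 𝟘 t) (sym (′-involutive x))
      (subst (Sum ((x ′) ′) 𝟘) (E3-uniq x′+v≡𝟙) x″+𝟘≡v)

  ≤-refl : ∀ x → x ≤ x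
  ≤-refl x = 𝟘 , +-identityʳ x

  ≤-trans : ∀ {x y z} → x ≤ y → y ≤ z → x ≤ z
  ≤-trans (_ , x+s≡y) (_ , y+t≡z) with E2→ x+s≡y y+t≡z
  ... | v , _ , x+v≡z = v , x+v≡z

  ≤-𝟙 : ∀ x → x ≤ 𝟙
  ≤-𝟙 x = x ′ , E3-sum x

  ′-antitone : ∀ {x y} → x ≤ y → (y ′) ≤ (x ′)
  ′-antitone {x} {y} (z , x+z≡y) with E2→ x+z≡y (E3-sum y)
  ... | v , z+y′≡v , x+v≡𝟙 = z , subst (Sum (y ′) z) (E3-uniq x+v≡𝟙) (E1 z+y′≡v)

  +-monoʳ-≤ : ∀ {x u y s m} → Sum x u s → u ≤ y → Sum x y m → s ≤ m
  +-monoʳ-≤ x+u≡s (t , u+t≡y) x+y≡m with E2← u+t≡y x+y≡m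
  ... | s′ , x+u≡s′ , s′+t≡m = t , subst (λ k → Sum k t _) (Sum-functional x+u≡s′ x+u≡s) s′+t≡m

  ≤′⇒summable : ∀ {x y} → x ≤ (y ′) → Σ Carrier (Sum x y)
  ≤′⇒summable {x} {y} (t , x+t≡y′) with E2← x+t≡y′ (E3-sum y)
  ... | m , y+x≡m , _ = m , E1 y+x≡m

  lowerBound-pair : ∀ {x y z} → z ≤ x → z ≤ y → L₂ x y z
  lowerBound-pair z≤x _ _ (inj₁ refl) = z≤x
  lowerBound-pair _ z≤y _ (inj₂ refl) = z≤y

  IsGreatest : Subset → Carrier → Set ℓ
  IsGreatest A m = A m × (∀ x → A x → x ≤ m)

  U-greatest : ∀ {A B m} → IsGreatest A m → IsGreatest B m → U A ≐ U B
  U-greatest (Am , A≤m) (Bm , B≤m) = upper Am B≤m , upper Bm A≤m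
    where
    upper : ∀ {A B m} → A m → (∀ x → B x → x ≤ m) → ∀ w → U A w → U B w
    upper Am B≤m w Aw≤ x Bx = ≤-trans (B≤m x Bx) (Aw≤ _ Am)

  ⇒-greatest-𝟙 : ∀ {x y} → x ≤ y → IsGreatest (x ⇒ y) 𝟙
  ⇒-greatest-𝟙 {x} x≤y = (x , lowerBound-pair (≤-refl x) x≤y , E1 (E3-sum x)) , λ z _ → ≤-𝟙 z

  ⇒-greatest : ∀ {x y m} → y ≤ x → Sum (x ′) y m → IsGreatest (x ⇒ y) m
  ⇒-greatest {y = y} y≤x x′+y≡m =
    (y , lowerBound-pair y≤x (≤-refl y) , x′+y≡m) ,
    λ { _ (u , u∈L , x′+u≡z) → +-monoʳ-≤ x′+u≡z (u∈L y (inj₂ refl)) x′+y≡m }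

proposition14 : {ℓ : Level} (𝐄 : EffectAlgebra ℓ) →
    let open EffectAlgebraTheory 𝐄 in
    (a b : Carrier) → (a ≤ b) ⊎ (b ≤ a) →
    U (a ⇒ b) ≐ U ((b ′) ⇒ (a ′))
proposition14 𝐄 a b a≤b⊎b≤a = greatest-shared a≤b⊎b≤a
  where
  open EffectAlgebraTheory 𝐄
  open EffectAlgebraProperties 𝐄

  greatest-shared : (a ≤ b) ⊎ (b ≤ a) → U (a ⇒ b) ≐ U ((b ′) ⇒ (a ′))
  greatest-shared (inj₁ a≤b) = U-greatest (⇒-greatest-𝟙 a≤b) (⇒-greatest-𝟙 (′-antitone a≤b))
  greatest-shared (inj₂ b≤a) with ≤′⇒summable (′-antitone b≤a)
  ... | m , a′+b≡m =
    U-greatest (⇒-greatest b≤a a′+b≡m)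
      (⇒-greatest (′-antitone b≤a) (subst (λ k → Sum k (a ′) m) (′-involutive b) (E1 a′+b≡m)))
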